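{- If $L$ is a finite ranked lattice with at least two elements, then $\mathcal{M}(L,1)=0$.
   Context: A ranked finite poset $\mathcal{P}$ has a rank function $\mathrm{rk}$ (all maximal chains have the same length, $\mathrm{rk}$ of minimal elements $0$), and $\mathrm{rk}(\mathcal{P})$ is the maximal rank. $\mathcal{F}l^3(\mathcal{P})=\{(x,y,z):x\le y\le z\}$, $J:\mathcal{F}l^3(\mathcal{P})\to\mathbb{Z}$ is defined by $\sum_{x\le a\le y\le b\le z}J(a,y,b)=\delta_3(x,y,z)$ with $\delta_3(x,y,z)=1$ iff $x=y=z$ (else $0$). The $J$-Möbius polynomial is $\mathcal{M}(\mathcal{P},t)=\sum_{(x,y,z)\in\mathcal{F}l^3(\mathcal{P})}J(x,y,z)\,t^{3\mathrm{rk}(\mathcal{P})-\mathrm{rk}(x)-\mathrm{rk}(y)-\mathrm{rk}(z)}$. -}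

module Defs where

open import Data.Nat as ℕ using (ℕ; zero; suc; _⊔_; _∸_)
open import Data.Fin using (Fin; zero; suc)
open import Data.Integer as ℤ using (ℤ; 0ℤ; 1ℤ)
open import Data.Product using (Σ; ∃; _×_; _,_)
open import Relation.Binary.PropositionalEquality using (_≡_; _≢_)
open import Relation.Binary.Core using (Rel)
open import Relation.Binary.Definitions using (Decidable)
open import Relation.Binary.Structures using (IsPartialOrder)
open import Relation.Nullary using (¬_; yes; no)
open import Level using (0ℓ)

record FinPoset (n : ℕ) : Set₁ where
  field
    _≼_            : Fin n → Fin n → Set
    isPartialOrder : IsPartialOrder _≡_ _≼_
    _≼?_           : Decidable _≼_

module _ {n : ℕ} (P : FinPoset n) where
  open FinPoset P

  _≺_ : Fin n → Fin n → Set
  x ≺ y = x ≼ y × x ≢ y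

  _⋖_ : Fin n → Fin n → Set
  x ⋖ y = x ≺ y × (∀ z → ¬ (x ≺ z × z ≺ y))

  IsMinimal : Fin n → Set
  IsMinimal x = ∀ y → y ≼ x → y ≡ x

  IsJoin : Fin n → Fin n → Fin n → Set
  IsJoin x y j = x ≼ j × y ≼ j × (∀ u → x ≼ u → y ≼ u → j ≼ u)

  IsMeet : Fin n → Fin n → Fin n → Set
  IsMeet x y m = m ≼ x × m ≼ y × (∀ u → u ≼ x → u ≼ y → u ≼ m)

  IsLattice : Set
  IsLattice = (∀ x y → ∃ λ j → IsJoin x y j) × (∀ x y → ∃ λ m → IsMeet x y m)

  IsRankFunction : (Fin n → ℕ) → Set
  IsRankFunction rk = (∀ x → IsMinimal x → rk x ≡ 0)
                    × (∀ x y → x ⋖ y → rk y ≡ suc (rk x))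

sumFin : ∀ {n} → (Fin n → ℤ) → ℤ
sumFin {zero}  f = 0ℤ
sumFin {suc n} f = f zero ℤ.+ sumFin (λ i → f (suc i))

maxFin : ∀ {n} → (Fin n → ℕ) → ℕ
maxFin {zero}  f = 0
maxFin {suc n} f = f zero ⊔ maxFin (λ i → f (suc i))

module _ {n : ℕ} (P : FinPoset n) where
  open FinPoset P

  [_≼_] : Fin n → Fin n → ℤ
  [ x ≼ y ] with x ≼? y
  ... | yes _ = 1ℤ
  ... | no  _ = 0ℤ

  δ₃ : Fin n → Fin n → Fin n → ℤ
  δ₃ x y z with x Data.Fin.≟ y | y Data.Fin.≟ z
  ... | yes _ | yes _ = 1ℤ
  ... | _     | _     = 0ℤ

  IsJFunction : (Fin n → Fin n → Fin n → ℤ) → Set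
  IsJFunction J = ∀ x y z → x ≼ y → y ≼ z →
    sumFin (λ a → sumFin (λ b →
      [ x ≼ a ] ℤ.* [ a ≼ y ] ℤ.* [ y ≼ b ] ℤ.* [ b ≼ z ] ℤ.* J a y b))
    ≡ δ₃ x y z

  rankOf : (Fin n → ℕ) → ℕ
  rankOf rk = maxFin rk

  MöbiusPoly : (Fin n → ℕ) → (Fin n → Fin n → Fin n → ℤ) → ℤ → ℤ
  MöbiusPoly rk J t = sumFin (λ x → sumFin (λ y → sumFin (λ z →
    [ x ≼ y ] ℤ.* [ y ≼ z ] ℤ.* J x y z
      ℤ.* (t ℤ.^ (3 ℕ.* rankOf rk ∸ rk x ∸ rk y ∸ rk z)))))

-- Evaluating at t = 1 removes the ranks, so M(L,1) is the sum of J over all flags.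
-- A finite lattice has a least element ⊥ and a greatest element ⊤. Summing first over the
-- middle element y, the flags with middle y are exactly the terms of the defining relation
-- of J at (⊥, y, ⊤), because ⊥ ≤ a and b ≤ ⊤ always hold. Hence M(L,1) = Σ_y δ₃(⊥, y, ⊤),
-- which vanishes since ⊥ ≠ ⊤ in a lattice with two elements.
module Submission where

open import Defs
open import Data.Nat as ℕ using (ℕ; zero; suc; _≤_; s≤s; z≤n)
open import Data.Fin using (Fin; zero; suc; _≟_)
open import Data.Fin.Properties using (0≢1+n)
open import Data.Integer using (ℤ; 0ℤ; 1ℤ; _+_; _*_)
open import Data.Integer.Properties using (+-0-commutativeMonoid; *-identityˡ; *-identityʳ; ^-zeroˡ)
open import Algebra.Properties.CommutativeMonoid.Sum +-0-commutativeMonoid using (sum; ∑-comm)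
open import Data.Product using (∃; _,_)
open import Function using (_∘_; flip)
open import Relation.Nullary using (yes; no)
open import Relation.Nullary.Negation using (contradiction)
open import Relation.Binary.PropositionalEquality
  using (_≡_; _≢_; _≗_; refl; sym; trans; cong; cong₂; module ≡-Reasoning)
open import Relation.Binary.Structures using (IsPartialOrder)
import Relation.Binary.Construct.Flip.EqAndOrd as Flip

open ≡-Reasoning

sumFin≡sum : ∀ {n} (f : Fin n → ℤ) → sumFin f ≡ sum f
sumFin≡sum {zero}  f = refl
sumFin≡sum {suc n} f = cong (f zero +_) (sumFin≡sum (f ∘ suc))

sumFin-cong : ∀ {n} {f g : Fin n → ℤ} → f ≗ g → sumFin f ≡ sumFin g
sumFin-cong {zero}  f≗g = refl
sumFin-cong {suc n} f≗g = cong₂ _+_ (f≗g zero) (sumFin-cong (f≗g ∘ suc))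

sumFin-zero : ∀ {n} {f : Fin n → ℤ} → (∀ i → f i ≡ 0ℤ) → sumFin f ≡ 0ℤ
sumFin-zero {zero}  f≡0 = refl
sumFin-zero {suc n} f≡0 = cong₂ _+_ (f≡0 zero) (sumFin-zero (f≡0 ∘ suc))

sumFin-comm : ∀ {m n} (f : Fin m → Fin n → ℤ) →
  sumFin (λ i → sumFin (f i)) ≡ sumFin (λ j → sumFin (λ i → f i j))
sumFin-comm f = begin
  sumFin (λ i → sumFin (f i))       ≡⟨ sumFin-cong (sumFin≡sum ∘ f) ⟩
  sumFin (λ i → sum (f i))          ≡⟨ sumFin≡sum (λ i → sum (f i)) ⟩
  sum (λ i → sum (f i))             ≡⟨ ∑-comm f ⟩
  sum (λ j → sum (λ i → f i j))     ≡˘⟨ sumFin≡sum (λ j → sum (λ i → f i j)) ⟩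
  sumFin (λ j → sum (λ i → f i j))  ≡˘⟨ sumFin-cong (λ j → sumFin≡sum (λ i → f i j)) ⟩
  sumFin (λ j → sumFin (λ i → f i j)) ∎

dual : ∀ {n} → FinPoset n → FinPoset n
dual P = record
  { _≼_            = flip _≼_
  ; isPartialOrder = Flip.isPartialOrder isPartialOrder
  ; _≼?_           = flip _≼?_
  }
  where open FinPoset P

module _ {n : ℕ} (P : FinPoset n) where
  open FinPoset P
  open IsPartialOrder isPartialOrder using (antisym) renaming (refl to ≼-refl; trans to ≼-trans)

  HasMeets : Set
  HasMeets = ∀ x y → ∃ (IsMeet P x y)

  lowerBound : HasMeets → ∀ {k} (f : Fin (suc k) → Fin n) → ∃ λ m → ∀ i → m ≼ f i
  lowerBound meets {zero}  f = f zero , λ { zero → ≼-refl }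
  lowerBound meets {suc k} f with lowerBound meets (f ∘ suc)
  ... | m₁ , m₁≼f with meets (f zero) m₁
  ... | m , m≼f₀ , m≼m₁ , _ = m , λ { zero → m≼f₀ ; (suc i) → ≼-trans m≼m₁ (m₁≼f i) }

  least≢greatest : ∀ {⊥ ⊤} → (∀ a → ⊥ ≼ a) → (∀ a → a ≼ ⊤) → ∀ {x y} → x ≢ y → ⊥ ≢ ⊤
  least≢greatest ⊥≼ ≼⊤ {x} {y} x≢y refl = x≢y (trans (collapse x) (sym (collapse y)))
    where
    collapse : ∀ a → a ≡ _
    collapse a = antisym (≼⊤ a) (⊥≼ a)

  [≼]≡1 : ∀ {a b} → a ≼ b → [_≼_] P a b ≡ 1ℤ
  [≼]≡1 {a} {b} a≼b with a ≼? b
  ... | yes _   = refl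
  ... | no  a⋠b = contradiction a≼b a⋠b

  δ₃-≢ : ∀ {x z} → x ≢ z → ∀ y → δ₃ P x y z ≡ 0ℤ
  δ₃-≢ {x} {z} x≢z y with x ≟ y | y ≟ z
  ... | yes x≡y | yes y≡z = contradiction (trans x≡y y≡z) x≢z
  ... | yes _   | no  _   = refl
  ... | no  _   | _       = refl

  flagSum : (Fin n → Fin n → Fin n → ℤ) → ℤ
  flagSum J = sumFin (λ x → sumFin (λ y → sumFin (λ z → [_≼_] P x y * [_≼_] P y z * J x y z)))

  MöbiusPoly-at-1 : ∀ rk J → MöbiusPoly P rk J 1ℤ ≡ flagSum J
  MöbiusPoly-at-1 rk J = sumFin-cong λ x → sumFin-cong λ y → sumFin-cong λ z →
    trans (cong ([_≼_] P x y * [_≼_] P y z * J x y z *_)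
                (^-zeroˡ (3 ℕ.* rankOf P rk ℕ.∸ rk x ℕ.∸ rk y ℕ.∸ rk z)))
          (*-identityʳ _)

  flagSum-bounded : ∀ {⊥ ⊤} → (∀ a → ⊥ ≼ a) → (∀ a → a ≼ ⊤) →
    ∀ J → IsJFunction P J → flagSum J ≡ sumFin (λ y → δ₃ P ⊥ y ⊤)
  flagSum-bounded {⊥} {⊤} ⊥≼ ≼⊤ J isJ = begin
    flagSum J
      ≡⟨ sumFin-comm (λ a y → sumFin (λ b → [ a ≼ y ]₁ * [ y ≼ b ]₁ * J a y b)) ⟩
    sumFin (λ y → sumFin (λ a → sumFin (λ b → [ a ≼ y ]₁ * [ y ≼ b ]₁ * J a y b)))
      ≡˘⟨ sumFin-cong (λ y → sumFin-cong λ a → sumFin-cong λ b → bounds-are-1 a y b) ⟩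
    sumFin (λ y → sumFin (λ a → sumFin (λ b →
      [ ⊥ ≼ a ]₁ * [ a ≼ y ]₁ * [ y ≼ b ]₁ * [ b ≼ ⊤ ]₁ * J a y b)))
      ≡⟨ sumFin-cong (λ y → isJ ⊥ y ⊤ (⊥≼ y) (≼⊤ y)) ⟩
    sumFin (λ y → δ₃ P ⊥ y ⊤) ∎
    where
    [_≼_]₁ : Fin n → Fin n → ℤ
    [_≼_]₁ = [_≼_] P

    bounds-are-1 : ∀ a y b → [ ⊥ ≼ a ]₁ * [ a ≼ y ]₁ * [ y ≼ b ]₁ * [ b ≼ ⊤ ]₁ * J a y b
                           ≡ [ a ≼ y ]₁ * [ y ≼ b ]₁ * J a y b
    bounds-are-1 a y b = begin
      [ ⊥ ≼ a ]₁ * [ a ≼ y ]₁ * [ y ≼ b ]₁ * [ b ≼ ⊤ ]₁ * J a y b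
        ≡⟨ cong₂ (λ p q → p * [ a ≼ y ]₁ * [ y ≼ b ]₁ * q * J a y b) ([≼]≡1 (⊥≼ a)) ([≼]≡1 (≼⊤ b)) ⟩
      1ℤ * [ a ≼ y ]₁ * [ y ≼ b ]₁ * 1ℤ * J a y b
        ≡⟨ cong (_* J a y b) (*-identityʳ (1ℤ * [ a ≼ y ]₁ * [ y ≼ b ]₁)) ⟩
      1ℤ * [ a ≼ y ]₁ * [ y ≼ b ]₁ * J a y b
        ≡⟨ cong (λ u → u * [ y ≼ b ]₁ * J a y b) (*-identityˡ [ a ≼ y ]₁) ⟩
      [ a ≼ y ]₁ * [ y ≼ b ]₁ * J a y b ∎

module _ {k : ℕ} (P : FinPoset (suc k)) where
  open FinPoset P

  least : HasMeets P → ∃ λ ⊥ → ∀ a → ⊥ ≼ a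
  least meets = lowerBound P meets (λ a → a)

  -- HasMeets (dual P) is definitionally the existence of joins in P.
  greatest : HasMeets (dual P) → ∃ λ ⊤ → ∀ a → a ≼ ⊤
  greatest joins = lowerBound (dual P) joins (λ a → a)

proposition6p4 : (n : ℕ) → 2 ≤ n → (L : FinPoset n) → IsLattice L →
    (rk : Fin n → ℕ) → IsRankFunction L rk →
    (J : Fin n → Fin n → Fin n → ℤ) → IsJFunction L J →
    MöbiusPoly L rk J 1ℤ ≡ 0ℤ
proposition6p4 (suc (suc k)) (s≤s (s≤s z≤n)) L (joins , meets) rk _ J isJ
  with least L meets | greatest L joins
... | ⊥ , ⊥≼ | ⊤ , ≼⊤ = begin
  MöbiusPoly L rk J 1ℤ       ≡⟨ MöbiusPoly-at-1 L rk J ⟩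
  flagSum L J                ≡⟨ flagSum-bounded L ⊥≼ ≼⊤ J isJ ⟩
  sumFin (λ y → δ₃ L ⊥ y ⊤)  ≡⟨ sumFin-zero (δ₃-≢ L (least≢greatest L ⊥≼ ≼⊤ (0≢1+n {i = zero}))) ⟩
  0ℤ                         ∎
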